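{- Let $D_0$ be a diagram. Suppose there exist $D\in KD(D_0)$ and positive integers $r,r',c,c'$ with $1\le c<c'$ and $1\le r<r'-1$ such that: (1) $(r',c')\in D$ and $(r',\tilde c)\notin D$ for all $\tilde c>c'$; (2) $(\tilde r,c)\in D$ for all $r<\tilde r\le r'$; (3) $(r,c)\notin D$; (4) for each $\tilde r$ with $r<\tilde r<r'-1$ there exists $\tilde c>c$ with $(\tilde r,\tilde c)\in D$; (5) for each $\tilde c>c$ there exists $\tilde r$ with $1\le\tilde r<r'$ and $(\tilde r,\tilde c)\notin D$. Then $\mathcal{P}(D_0)$ is not ranked.
   Context: A diagram is a finite set $D$ of cells $(r,c)$ with $r,c$ positive integers; $r$ is the row (rows numbered from bottom to top starting at 1) and $c$ the column (numbered from left to right starting at 1). A Kohnert move at row $r$ applied to a diagram $D$: if row $r$ of $D$ is empty, $D$ is unchanged; otherwise let $(r,c)$ be the cell of row $r$ with the largest column index; if every position $(r',c)$ with $1\le r'<r$ belongs to $D$, then $D$ is unchanged; otherwise let $r'$ be the largest integer with $1\le r'<r$ and $(r',c)\notin D$, and the move replaces the cell $(r,c)$ by $(r',c)$. For a diagram $D_0$, $KD(D_0)$ is the set of all diagrams obtainable from $D_0$ by finite (possibly empty) sequences of Kohnert moves. The Kohnert poset $\mathcal{P}(D_0)$ is $KD(D_0)$ ordered by $D_2\preceq D_1$ iff $D_2$ can be obtained from $D_1$ by a finite sequence of Kohnert moves. A finite poset $P$ is ranked if there is a function $\rho:P\to\mathbb{Z}_{\ge0}$ such that $x\prec y$ implies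 $\rho(x)<\rho(y)$ and $\rho(y)=\rho(x)+1$ whenever $y$ covers $x$. -}

module Defs where

open import Data.Nat using (ℕ; zero; suc; _≤_; _<_; _∸_; _+_; _⊔_)
import Data.Nat as ℕ
open import Data.Bool using (Bool; true; false; if_then_else_)
open import Data.Maybe using (Maybe; just; nothing)
open import Data.Product using (_×_; _,_; Σ; ∃; ∃-syntax)
import Data.Product.Properties as PP
open import Data.List using (List; []; _∷_; filter)
open import Data.List.Membership.Propositional using (_∈_; _∉_)
open import Data.List.Membership.DecPropositional using () renaming (_∈?_ to mem?)
open import Data.List.Relation.Unary.All using (All)
open import Relation.Binary.PropositionalEquality using (_≡_)
open import Relation.Binary.Definitions using (DecidableEquality)
open import Relation.Binary.Construct.Closure.ReflexiveTransitive using (Star)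
open import Relation.Nullary using (¬_; yes; no; Dec; ¬?)
open import Relation.Nullary.Decidable using (⌊_⌋)
open import Data.Empty using (⊥)

-- A cell (r , c): r = row (bottom to top, from 1), c = column (from 1).
Cell : Set
Cell = ℕ × ℕ

_≟c_ : DecidableEquality Cell
_≟c_ = PP.≡-dec ℕ._≟_ ℕ._≟_

_∈?_ : (x : Cell) → (D : List Cell) → Dec (x ∈ D)
_∈?_ = mem? _≟c_

-- A diagram is a finite set of cells, represented by a list; two lists
-- represent the same diagram iff they have the same members.
Diagram : Set
Diagram = List Cell

ValidDiagram : Diagram → Set
ValidDiagram D = All (λ x → 1 ≤ Data.Product.proj₁ x × 1 ≤ Data.Product.proj₂ x) D

_≈_ : Diagram → Diagram → Set
D ≈ E = ∀ x → (x ∈ D → x ∈ E) × (x ∈ E → x ∈ D)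

maxCol : ℕ → Diagram → Maybe ℕ
maxCol r [] = nothing
maxCol r ((r₁ , c₁) ∷ D) with r ℕ.≟ r₁ | maxCol r D
... | no _  | m       = m
... | yes _ | nothing = just c₁
... | yes _ | just m  = just (c₁ ⊔ m)

freeBelow : Diagram → ℕ → ℕ → Maybe ℕ
freeBelow D c zero = nothing
freeBelow D c (suc k) with (suc k , c) ∈? D
... | yes _ = freeBelow D c k
... | no _  = just (suc k)

kohnert : ℕ → Diagram → Diagram
kohnert r D with maxCol r D
... | nothing = D
... | just c with freeBelow D c (r ∸ 1)
...   | nothing = D
...   | just r' = (r' , c) ∷ filter (λ x → ¬? (x ≟c (r , c))) D

Step : Diagram → Diagram → Set
Step D E = ∃[ r ] E ≡ kohnert r D

_⪯_ : Diagram → Diagram → Set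
E ⪯ D = ∃[ F ] (Star Step D F × F ≈ E)

_∈KD_ : Diagram → Diagram → Set
D ∈KD D₀ = D ⪯ D₀

_≺_ : Diagram → Diagram → Set
E ≺ D = E ⪯ D × ¬ (E ≈ D)

Covers : Diagram → Diagram → Diagram → Set
Covers D₀ D E = E ≺ D × (∀ Z → Z ∈KD D₀ → E ≺ Z → Z ≺ D → ⊥)

-- P(D₀) is ranked: a rank function on its elements, well defined on
-- diagrams (invariant under set equality of representations)
Ranked : Diagram → Set
Ranked D₀ = Σ (Diagram → ℕ) λ ρ →
    (∀ D E → D ∈KD D₀ → E ∈KD D₀ → D ≈ E → ρ D ≡ ρ E)
  × (∀ D E → D ∈KD D₀ → E ∈KD D₀ → E ≺ D → ρ E < ρ D)
  × (∀ D E → D ∈KD D₀ → E ∈KD D₀ → Covers D₀ D E → ρ D ≡ suc (ρ E))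

-- Write r' = p + 1. Call a Kohnert move dropping the rightmost cell (t , j) of its row to (s , j)
-- supported when every row strictly between s and t has a cell right of column j. A supported
-- move D → E is a cover: column counts only grow along Kohnert moves, and from D the only move
-- keeping them below those of E is the move D → E itself.
-- From D, first drop the cells of row p right of c (condition (5) leaves room below them) until
-- row p ends at (p , c); dropping (p , c) to (r , c) is then a supported move W → J, so
-- ρ W = ρ J + 1. Next drop the cells of row p + 1 right of c by one row, in W and in J alike;
-- these moves are supported, so the relation persists. Once row p + 1 ends at (p + 1 , c),
-- dropping that cell to (r , c) in W and to (p , c) in J are supported moves to one diagram Y,
-- whence ρ W = ρ Y + 1 = ρ J, a contradiction.

module Submission where

open import Defs
open import Data.Nat using (ℕ; zero; suc; _≤_; _<_; _∸_; _+_; _⊔_; z≤n; s≤s)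
import Data.Nat as ℕ
open import Data.Nat.Properties
open import Data.Maybe using (Maybe; just; nothing)
open import Data.Product using (_×_; _,_; ∃-syntax; proj₁; proj₂)
open import Data.Sum using (_⊎_; inj₁; inj₂)
open import Data.List using ([]; _∷_; filter)
open import Data.List.Membership.Propositional using (_∈_; _∉_)
open import Data.List.Membership.Propositional.Properties using (∈-filter⁺; ∈-filter⁻)
open import Data.List.Relation.Unary.Any using (here; there)
open import Relation.Binary.PropositionalEquality
open import Relation.Nullary using (¬_; yes; no; ¬?; does)
open import Relation.Nullary.Decidable using (dec-true; dec-false; does-⇔)
open import Data.Bool using (if_then_else_)
open import Data.Bool.Properties using (if-float)
open import Function.Bundles using (_⇔_; mk⇔)
open import Data.Empty using (⊥; ⊥-elim)
open import Relation.Binary.Construct.Closure.ReflexiveTransitive using (Star; ε; _◅_; _◅◅_)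
open import Relation.Binary.Definitions using (tri<; tri≈; tri>)

RowMax : ℕ → Diagram → ℕ → Set
RowMax t D j = (t , j) ∈ D × (∀ z → (t , z) ∈ D → z ≤ j)

rowMax-unique : ∀ {t D j j'} → RowMax t D j → RowMax t D j' → j ≡ j'
rowMax-unique (j∈ , j-max) (j'∈ , j'-max) = ≤-antisym (j'-max _ j∈) (j-max _ j'∈)

rowMax-lower : ∀ {t D y j} → RowMax t D y → (t , j) ∈ D → y ≤ j → RowMax t D j
rowMax-lower (_ , y-max) j∈ y≤j = j∈ , λ z z∈ → ≤-trans (y-max z z∈) y≤j

data MaxColView (t : ℕ) (D : Diagram) : Maybe ℕ → Set where
  empty-row : (∀ z → (t , z) ∉ D) → MaxColView t D nothing
  max-col   : ∀ j → RowMax t D j → MaxColView t D (just j)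

maxCol-view : ∀ t D → MaxColView t D (maxCol t D)
maxCol-view t [] = empty-row λ _ ()
maxCol-view t ((t₁ , c₁) ∷ D) with t ℕ.≟ t₁ | maxCol t D | maxCol-view t D
... | no t≢t₁ | _ | empty-row none =
  empty-row λ { z (here refl) → t≢t₁ refl ; z (there z∈) → none z z∈ }
... | no t≢t₁ | _ | max-col j (j∈ , j-max) =
  max-col j (there j∈ , λ { z (here refl) → ⊥-elim (t≢t₁ refl)
                           ; z (there z∈) → j-max z z∈ })
... | yes refl | _ | empty-row none =
  max-col c₁ (here refl , λ { z (here refl) → ≤-refl ; z (there z∈) → ⊥-elim (none z z∈) })
... | yes refl | _ | max-col j (j∈ , j-max) =
  max-col (c₁ ⊔ j) (⊔-in , λ { z (here refl) → m≤m⊔n c₁ j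
                              ; z (there z∈) → m≤n⇒m≤o⊔n c₁ (j-max z z∈) })
  where
  ⊔-in : (t , c₁ ⊔ j) ∈ ((t , c₁) ∷ D)
  ⊔-in with ⊔-sel c₁ j
  ... | inj₁ e rewrite e = here refl
  ... | inj₂ e rewrite e = there j∈

≤-suc-elim : ∀ (P : ℕ → Set) {x k} → (x ≤ k → P x) → P (suc k) → x ≤ suc k → P x
≤-suc-elim P below top x≤k+1 with m≤n⇒m<n∨m≡n x≤k+1
... | inj₁ x<k+1 = below (≤-pred x<k+1)
... | inj₂ refl  = top

data FreeBelowView (D : Diagram) (j k : ℕ) : Maybe ℕ → Set where
  column-full : (∀ x → 1 ≤ x → x ≤ k → (x , j) ∈ D) → FreeBelowView D j k nothing
  free-at     : ∀ s → 1 ≤ s → s ≤ k → (s , j) ∉ D → (∀ x → s < x → x ≤ k → (x , j) ∈ D) →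
                FreeBelowView D j k (just s)

freeBelow-view : ∀ D j k → FreeBelowView D j k (freeBelow D j k)
freeBelow-view D j zero = column-full λ { _ () z≤n }
freeBelow-view D j (suc k) with (suc k , j) ∈? D
... | no k+1∉ =
  free-at (suc k) (s≤s z≤n) ≤-refl k+1∉ λ x k+1<x x≤k+1 → ⊥-elim (<⇒≱ k+1<x x≤k+1)
... | yes k+1∈ with freeBelow D j k | freeBelow-view D j k
...   | _ | column-full full =
  column-full λ x 1≤x → ≤-suc-elim (λ y → (y , j) ∈ D) (full x 1≤x) k+1∈
...   | _ | free-at s 1≤s s≤k s∉ above =
  free-at s 1≤s (m≤n⇒m≤1+n s≤k) s∉ λ x s<x → ≤-suc-elim (λ y → (y , j) ∈ D) (above x s<x) k+1∈

≤pred⇒< : ∀ {s t} → 1 ≤ s → s ≤ t ∸ 1 → s < t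
≤pred⇒< {suc s} {suc t} _ s+1≤t = s≤s s+1≤t

move : Diagram → Cell → Cell → Diagram
move D q p = p ∷ filter (λ x → ¬? (x ≟c q)) D

record Drop (D : Diagram) (t j s : ℕ) : Set where
  field
    rowMax : RowMax t D j
    1≤s    : 1 ≤ s
    s<t    : s < t
    free   : (s , j) ∉ D
    filled : ∀ x → s < x → x < t → (x , j) ∈ D

CellRightOf : Diagram → ℕ → ℕ → Set
CellRightOf D x j = ∃[ z ] (j < z × (x , z) ∈ D)

RightCellsBetween : Diagram → ℕ → ℕ → ℕ → Set
RightCellsBetween D t j s = ∀ x → s < x → x < t → CellRightOf D x j

data KohnertView (t : ℕ) (D : Diagram) : Diagram → Set where
  empty-row : (∀ z → (t , z) ∉ D) → KohnertView t D D
  blocked   : ∀ {j} → RowMax t D j → (∀ x → 1 ≤ x → x < t → (x , j) ∈ D) → KohnertView t D D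
  drop      : ∀ {j s} → Drop D t j s → KohnertView t D (move D (t , j) (s , j))

kohnert-view : ∀ t D → KohnertView t D (kohnert t D)
kohnert-view t D with maxCol t D | maxCol-view t D
... | nothing | empty-row none = empty-row none
... | just j  | max-col .j j-max with freeBelow D j (t ∸ 1) | freeBelow-view D j (t ∸ 1)
...   | nothing | column-full full = blocked j-max λ x 1≤x x<t → full x 1≤x (<⇒≤pred x<t)
...   | just s  | free-at .s 1≤s s≤t-1 s∉ above =
  drop (record { rowMax = j-max ; 1≤s = 1≤s ; s<t = ≤pred⇒< 1≤s s≤t-1 ; free = s∉
               ; filled = λ x s<x x<t → above x s<x (<⇒≤pred x<t) })

≈-refl : ∀ {D} → D ≈ D
≈-refl x = (λ x∈ → x∈) , (λ x∈ → x∈)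

≈-sym : ∀ {D E} → D ≈ E → E ≈ D
≈-sym D≈E x = proj₂ (D≈E x) , proj₁ (D≈E x)

≈-trans : ∀ {D E F} → D ≈ E → E ≈ F → D ≈ F
≈-trans D≈E E≈F x = (λ x∈ → proj₁ (E≈F x) (proj₁ (D≈E x) x∈)) ,
                     (λ x∈ → proj₂ (D≈E x) (proj₂ (E≈F x) x∈))

row≢ : ∀ {i i' j j' : ℕ} → i ≢ i' → (i , j) ≢ (i' , j')
row≢ i≢i' e = i≢i' (cong proj₁ e)

col≢ : ∀ {i i' j j' : ℕ} → j ≢ j' → (i , j) ≢ (i' , j')
col≢ j≢j' e = j≢j' (cong proj₂ e)

Moves : Diagram → Cell → Cell → Diagram → Set
Moves D q p E = ∀ x → (x ∈ E → x ≡ p ⊎ (x ∈ D × x ≢ q)) × (x ≡ p ⊎ (x ∈ D × x ≢ q) → x ∈ E)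

move-moves : ∀ D q p → Moves D q p (move D q p)
move-moves D q p x = to , from
  where
  to : x ∈ move D q p → x ≡ p ⊎ (x ∈ D × x ≢ q)
  to (here x≡p)  = inj₁ x≡p
  to (there x∈) = inj₂ (∈-filter⁻ (λ y → ¬? (y ≟c q)) x∈)
  from : x ≡ p ⊎ (x ∈ D × x ≢ q) → x ∈ move D q p
  from (inj₁ x≡p)        = here x≡p
  from (inj₂ (x∈ , x≢q)) = there (∈-filter⁺ (λ y → ¬? (y ≟c q)) x∈ x≢q)

module _ {D E : Diagram} {q p : Cell} (D⇝E : Moves D q p E) where

  moves-target : p ∈ E
  moves-target = proj₂ (D⇝E p) (inj₁ refl)

  moves-keep : ∀ {x} → x ∈ D → x ≢ q → x ∈ E
  moves-keep x∈ x≢q = proj₂ (D⇝E _) (inj₂ (x∈ , x≢q))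

  moves-source : ∀ {x} → x ∈ E → x ≢ p → x ∈ D
  moves-source x∈ x≢p with proj₁ (D⇝E _) x∈
  ... | inj₁ x≡p      = ⊥-elim (x≢p x≡p)
  ... | inj₂ (x∈D , _) = x∈D

  moves-vacates : p ≢ q → q ∉ E
  moves-vacates p≢q q∈ with proj₁ (D⇝E _) q∈
  ... | inj₁ q≡p      = p≢q (sym q≡p)
  ... | inj₂ (_ , q≢q) = q≢q refl

moves-cong : ∀ {D D' E E' q p} → D ≈ D' → Moves D q p E → Moves D' q p E' → E ≈ E'
moves-cong D≈D' D⇝E D'⇝E' x = to D≈D' D⇝E D'⇝E' , to (≈-sym D≈D') D'⇝E' D⇝E
  where
  to : ∀ {A A' B B' q p} → A ≈ A' → Moves A q p B → Moves A' q p B' → x ∈ B → x ∈ B'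
  to A≈A' A⇝B A'⇝B' x∈ with proj₁ (A⇝B x) x∈
  ... | inj₁ x≡p         = proj₂ (A'⇝B' x) (inj₁ x≡p)
  ... | inj₂ (x∈A , x≢q) = proj₂ (A'⇝B' x) (inj₂ (proj₁ (A≈A' x) x∈A , x≢q))

moves-comm : ∀ {W W' J J' q p q' p'} → Moves W q p W' → Moves J q p J' → Moves W q' p' J →
             p ≢ q' → p' ≢ q → Moves W' q' p' J'
moves-comm {W' = W'} {J' = J'} {q = q} {p} {q'} {p'} W⇝W' J⇝J' W⇝J p≢q' p'≢q x = to , from
  where
  to : x ∈ J' → x ≡ p' ⊎ (x ∈ W' × x ≢ q')
  to x∈J' with proj₁ (J⇝J' x) x∈J'
  ... | inj₁ refl = inj₂ (moves-target W⇝W' , p≢q')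
  ... | inj₂ (x∈J , x≢q) with proj₁ (W⇝J x) x∈J
  ...   | inj₁ x≡p'          = inj₁ x≡p'
  ...   | inj₂ (x∈W , x≢q') = inj₂ (moves-keep W⇝W' x∈W x≢q , x≢q')
  from : x ≡ p' ⊎ (x ∈ W' × x ≢ q') → x ∈ J'
  from (inj₁ refl) = moves-keep J⇝J' (moves-target W⇝J) p'≢q
  from (inj₂ (x∈W' , x≢q')) with proj₁ (W⇝W' x) x∈W'
  ... | inj₁ refl          = moves-target J⇝J'
  ... | inj₂ (x∈W , x≢q) = moves-keep J⇝J' (moves-keep W⇝J x∈W x≢q') x≢q

move-then-fill : ∀ {W J K L q₁ p₁ q₂} → Moves W q₁ p₁ J → Moves J q₂ q₁ K → Moves W q₂ p₁ L →
                 q₁ ∈ W → q₁ ≢ q₂ → p₁ ≢ q₂ → K ≈ L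
move-then-fill {K = K} {L} {q₁} {p₁} {q₂} W⇝J J⇝K W⇝L q₁∈W q₁≢q₂ p₁≢q₂ x = to , from
  where
  to : x ∈ K → x ∈ L
  to x∈K with proj₁ (J⇝K x) x∈K
  ... | inj₁ refl = moves-keep W⇝L q₁∈W q₁≢q₂
  ... | inj₂ (x∈J , x≢q₂) with proj₁ (W⇝J x) x∈J
  ...   | inj₁ refl         = moves-target W⇝L
  ...   | inj₂ (x∈W , _) = moves-keep W⇝L x∈W x≢q₂
  from : x ∈ L → x ∈ K
  from x∈L with proj₁ (W⇝L x) x∈L
  ... | inj₁ refl = moves-keep J⇝K (moves-target W⇝J) p₁≢q₂
  ... | inj₂ (x∈W , x≢q₂) with x ≟c q₁
  ...   | yes refl = moves-target J⇝K
  ...   | no x≢q₁  = moves-keep J⇝K (moves-keep W⇝J x∈W x≢q₁) x≢q₂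

kohnert-drop : ∀ {D t j s} → Drop D t j s → kohnert t D ≡ move D (t , j) (s , j)
kohnert-drop {D} {t} {j} {s} d with kohnert t D | kohnert-view t D
... | _ | empty-row none = ⊥-elim (none j (proj₁ (Drop.rowMax d)))
... | _ | blocked j'-max full with rowMax-unique (Drop.rowMax d) j'-max
...   | refl = ⊥-elim (Drop.free d (full s (Drop.1≤s d) (Drop.s<t d)))
kohnert-drop {D} {t} {j} {s} d | _ | drop {s = s'} d' with rowMax-unique (Drop.rowMax d) (Drop.rowMax d')
... | refl with <-cmp s s'
...   | tri< s<s' _ _ = ⊥-elim (Drop.free d' (Drop.filled d s' s<s' (Drop.s<t d')))
...   | tri≈ _ refl _ = refl
...   | tri> _ _ s'<s = ⊥-elim (Drop.free d (Drop.filled d' s s'<s (Drop.s<t d)))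

kohnert-moves : ∀ {D t j s} → Drop D t j s → Moves D (t , j) (s , j) (kohnert t D)
kohnert-moves {D} {t} {j} {s} d rewrite kohnert-drop d = move-moves D (t , j) (s , j)

drop-exists : ∀ {W t y x} → RowMax t W y → 1 ≤ x → x < t → (x , y) ∉ W → ∃[ s ] Drop W t y s
drop-exists {W} {t} y-max 1≤x x<t x∉ with kohnert t W | kohnert-view t W
... | _ | empty-row none = ⊥-elim (none _ (proj₁ y-max))
... | _ | blocked j-max full with rowMax-unique y-max j-max
...   | refl = ⊥-elim (x∉ (full _ 1≤x x<t))
drop-exists y-max 1≤x x<t x∉ | _ | drop {s = s} d with rowMax-unique y-max (Drop.rowMax d)
... | refl = s , d

drop-adjacent : ∀ {W s y} → RowMax (suc s) W y → 1 ≤ s → (s , y) ∉ W → Drop W (suc s) y s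
drop-adjacent y-max 1≤s s∉ = record
  { rowMax = y-max ; 1≤s = 1≤s ; s<t = n<1+n _ ; free = s∉
  ; filled = λ x s<x x<s+1 → ⊥-elim (<⇒≱ s<x (≤-pred x<s+1)) }

moves-rowMax : ∀ {W J i i' j j' t y} → Moves W (i , j) (i' , j') J → t ≢ i → t ≢ i' →
               RowMax t W y → RowMax t J y
moves-rowMax W⇝J t≢i t≢i' (y∈ , y-max) =
  moves-keep W⇝J y∈ (row≢ t≢i) , λ z z∈ → y-max z (moves-source W⇝J z∈ (row≢ t≢i'))

colCount : Diagram → ℕ → ℕ → ℕ
colCount D j zero    = 0
colCount D j (suc x) = if does ((suc x , j) ∈? D) then suc (colCount D j x) else colCount D j x

colCount-cong : ∀ {D E} j x → (∀ i → i ≤ x → (i , j) ∈ D ⇔ (i , j) ∈ E) → colCount D j x ≡ colCount E j x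
colCount-cong j zero    agree = refl
colCount-cong j (suc x) agree =
  cong₂ (λ b n → if b then suc n else n)
        (does-⇔ (agree (suc x) ≤-refl) ((suc x , j) ∈? _) ((suc x , j) ∈? _))
        (colCount-cong j x λ i i≤x → agree i (m≤n⇒m≤1+n i≤x))

colCount-≈ : ∀ {D E} → D ≈ E → ∀ j x → colCount D j x ≡ colCount E j x
colCount-≈ D≈E j x = colCount-cong j x λ i _ → mk⇔ (proj₁ (D≈E (i , j))) (proj₂ (D≈E (i , j)))

module DropCount {D E t j s} (d : Drop D t j s) (D⇝E : Moves D (t , j) (s , j) E) where
  open Drop d

  private
    agree : ∀ {x} → x ≢ (s , j) → x ≢ (t , j) → x ∈ E ⇔ x ∈ D
    agree ≢s ≢t = mk⇔ (λ x∈ → moves-source D⇝E x∈ ≢s) (λ x∈ → moves-keep D⇝E x∈ ≢t)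

    does-agree : ∀ {x} → x ≢ (s , j) → x ≢ (t , j) → does (x ∈? E) ≡ does (x ∈? D)
    does-agree {x} ≢s ≢t = does-⇔ (agree ≢s ≢t) (x ∈? E) (x ∈? D)

  colCount-other : ∀ {j'} x → j' ≢ j → colCount E j' x ≡ colCount D j' x
  colCount-other {j'} x j'≢j = colCount-cong j' x λ i _ → agree (col≢ j'≢j) (col≢ j'≢j)

  colCount-below : ∀ x → x < s → colCount E j x ≡ colCount D j x
  colCount-below x x<s = colCount-cong j x λ i i≤x →
    let i<s = ≤-<-trans i≤x x<s in agree (row≢ (<⇒≢ i<s)) (row≢ (<⇒≢ (<-trans i<s s<t)))

  colCount-between : ∀ x → s ≤ x → x < t → colCount E j x ≡ suc (colCount D j x)
  colCount-between zero s≤0 _ = ⊥-elim (<⇒≱ 1≤s s≤0)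
  colCount-between (suc x) s≤x+1 x+1<t with m≤n⇒m<n∨m≡n s≤x+1
  ... | inj₂ refl
    rewrite dec-true ((suc x , j) ∈? E) (moves-target D⇝E) | dec-false ((suc x , j) ∈? D) free
    = cong suc (colCount-below x ≤-refl)
  ... | inj₁ s<x+1 = begin
    colCount E j (suc x)
      ≡⟨ cong₂ (λ b n → if b then suc n else n)
               (does-agree (row≢ (>⇒≢ s<x+1)) (row≢ (<⇒≢ x+1<t)))
               (colCount-between x (≤-pred s<x+1) (<-trans (n<1+n x) x+1<t)) ⟩
    (if does ((suc x , j) ∈? D) then suc (suc (colCount D j x)) else suc (colCount D j x))
      ≡⟨ if-float suc (does ((suc x , j) ∈? D)) ⟨
    suc (colCount D j (suc x)) ∎
    where open ≡-Reasoning

  colCount-above : ∀ x → t ≤ x → colCount E j x ≡ colCount D j x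
  colCount-above zero t≤0 = ⊥-elim (<⇒≱ (≤-<-trans z≤n s<t) t≤0)
  colCount-above (suc x) t≤x+1 with m≤n⇒m<n∨m≡n t≤x+1
  ... | inj₂ refl
    rewrite dec-false ((suc x , j) ∈? E) (moves-vacates D⇝E (row≢ (<⇒≢ s<t)))
          | dec-true ((suc x , j) ∈? D) (proj₁ rowMax)
    = colCount-between x (≤-pred s<t) ≤-refl
  ... | inj₁ t<x+1 =
    cong₂ (λ b n → if b then suc n else n)
          (does-agree (row≢ (>⇒≢ (<-trans s<t t<x+1))) (row≢ (>⇒≢ t<x+1)))
          (colCount-above x (≤-pred t<x+1))

  colCount-drop : ∀ j' x → (j' ≡ j × s ≤ x × x < t × colCount E j' x ≡ suc (colCount D j' x))
                           ⊎ colCount E j' x ≡ colCount D j' x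
  colCount-drop j' x with j' ℕ.≟ j
  ... | no j'≢j = inj₂ (colCount-other x j'≢j)
  ... | yes refl with x ℕ.<? s
  ...   | yes x<s = inj₂ (colCount-below x x<s)
  ...   | no x≮s with x ℕ.<? t
  ...     | yes x<t = inj₁ (refl , ≮⇒≥ x≮s , x<t , colCount-between x (≮⇒≥ x≮s) x<t)
  ...     | no x≮t  = inj₂ (colCount-above x (≮⇒≥ x≮t))

  colCount-mono : ∀ j' x → colCount D j' x ≤ colCount E j' x
  colCount-mono j' x with colCount-drop j' x
  ... | inj₁ (_ , _ , _ , grows) = ≤-trans (n≤1+n _) (≤-reflexive (sym grows))
  ... | inj₂ same                = ≤-reflexive (sym same)

  colCount-grows : ∀ j' x → colCount D j' x < colCount E j' x → j' ≡ j × s ≤ x × x < t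
  colCount-grows j' x lt with colCount-drop j' x
  ... | inj₁ (j'≡j , s≤x , x<t , _) = j'≡j , s≤x , x<t
  ... | inj₂ same                    = ⊥-elim (<-irrefl (sym same) lt)

colCount-mono-Step : ∀ {D E} → Step D E → ∀ j x → colCount D j x ≤ colCount E j x
colCount-mono-Step {D} (t , refl) with kohnert t D | kohnert-view t D
... | _ | empty-row _ = λ _ _ → ≤-refl
... | _ | blocked _ _ = λ _ _ → ≤-refl
... | _ | drop d      = DropCount.colCount-mono d (move-moves D _ _)

colCount-mono-Star : ∀ {D E} → Star Step D E → ∀ j x → colCount D j x ≤ colCount E j x
colCount-mono-Star ε        j x = ≤-refl
colCount-mono-Star (st ◅ p) j x = ≤-trans (colCount-mono-Step st j x) (colCount-mono-Star p j x)

module DropCovers {D t j s} (d : Drop D t j s) (support : RightCellsBetween D t j s) where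
  open Drop d

  E : Diagram
  E = kohnert t D

  D⇝E : Moves D (t , j) (s , j) E
  D⇝E = kohnert-moves d

  open DropCount d D⇝E using (colCount-grows)

  Endpoint : Diagram → Set
  Endpoint V = V ≈ D ⊎ V ≈ E

  BelowE : Diagram → Set
  BelowE V = ∀ j' x → colCount V j' x ≤ colCount E j' x

  drop-endpoint : ∀ {V k y k'} → Drop V k y k' → Endpoint V → BelowE (move V (k , y) (k' , y)) →
                  move V (k , y) (k' , y) ≈ E
  drop-endpoint {V} {k} {y} {k'} d' end bound = lands end
    where
    V' = move V (k , y) (k' , y)
    open DropCount d' (move-moves V (k , y) (k' , y)) using (colCount-between)

    V<V' : ∀ x → k' ≤ x → x < k → colCount V y x < colCount V' y x
    V<V' x k'≤x x<k = ≤-reflexive (sym (colCount-between x k'≤x x<k))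

    D<E : V ≈ D → ∀ x → k' ≤ x → x < k → colCount D y x < colCount E y x
    D<E V≈D x k'≤x x<k =
      subst (_< colCount E y x) (colCount-≈ V≈D y x) (<-≤-trans (V<V' x k'≤x x<k) (bound y x))

    lands : Endpoint V → V' ≈ E
    lands (inj₂ V≈E) = ⊥-elim (<-irrefl refl (subst (_< colCount E y k') (colCount-≈ V≈E y k')
                                                    (<-≤-trans (V<V' k' ≤-refl (Drop.s<t d')) (bound y k'))))
    lands (inj₁ V≈D) with colCount-grows y k' (D<E V≈D k' ≤-refl (Drop.s<t d'))
    ... | refl , s≤k' , k'<t with <-cmp k t
    ...   | tri< k<t _ _ = let (z , j<z , z∈) = support k (≤-<-trans s≤k' (Drop.s<t d')) k<t
                           in ⊥-elim (<⇒≱ j<z (proj₂ (Drop.rowMax d') z (proj₂ (V≈D _) z∈)))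
    ...   | tri> _ _ t<k =
      let (_ , _ , t<t) = colCount-grows y t (D<E V≈D t (<⇒≤ k'<t) t<k) in ⊥-elim (<-irrefl refl t<t)
    ...   | tri≈ _ refl _ with <-cmp k' s
    ...     | tri< k'<s _ _ = ⊥-elim (<⇒≱ k'<s s≤k')
    ...     | tri> _ _ s<k' = ⊥-elim (Drop.free d' (proj₂ (V≈D _) (filled k' s<k' k'<t)))
    ...     | tri≈ _ refl _ = moves-cong V≈D (move-moves V (k , y) (k' , y)) D⇝E

  step-endpoint : ∀ {V V'} → Step V V' → Endpoint V → BelowE V' → Endpoint V'
  step-endpoint {V} (k , refl) end bound with kohnert k V | kohnert-view k V
  ... | _ | empty-row _ = end
  ... | _ | blocked _ _ = end
  ... | _ | drop d'     = inj₂ (drop-endpoint d' end bound)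

  path-endpoint : ∀ {V F} → Star Step V F → Endpoint V → BelowE F → Endpoint F
  path-endpoint ε        end bound = end
  path-endpoint (st ◅ p) end bound =
    path-endpoint p (step-endpoint st end λ j' x → ≤-trans (colCount-mono-Star p j' x) (bound j' x))
                  bound

  ⪯E⇒BelowE : ∀ {Z F} → E ⪯ Z → F ≈ Z → BelowE F
  ⪯E⇒BelowE {Z} {F} (G , Z⇝G , G≈E) F≈Z j' x = begin
    colCount F j' x ≡⟨ colCount-≈ F≈Z j' x ⟩
    colCount Z j' x ≤⟨ colCount-mono-Star Z⇝G j' x ⟩
    colCount G j' x ≡⟨ colCount-≈ G≈E j' x ⟩
    colCount E j' x ∎
    where open ≤-Reasoning

  covers : ∀ D₀ → Covers D₀ D E
  covers D₀ = E≺D , nothing-between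
    where
    E≺D : E ≺ D
    E≺D = (E , (t , refl) ◅ ε , ≈-refl) , λ E≈D → free (proj₁ (E≈D _) (moves-target D⇝E))

    nothing-between : ∀ Z → Z ∈KD D₀ → E ≺ Z → Z ≺ D → ⊥
    nothing-between Z _ (E⪯Z , E≉Z) ((F , D⇝F , F≈Z) , Z≉D)
      with path-endpoint D⇝F (inj₁ ≈-refl) (⪯E⇒BelowE E⪯Z F≈Z)
    ... | inj₁ F≈D = Z≉D (≈-trans (≈-sym F≈Z) F≈D)
    ... | inj₂ F≈E = E≉Z (≈-trans (≈-sym F≈E) F≈Z)

rowSum : Diagram → ℕ
rowSum []             = 0
rowSum ((i , _) ∷ D) = i + rowSum D

rowSum-remove : ∀ D q → rowSum (filter (λ x → ¬? (x ≟c q)) D) ≤ rowSum D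
rowSum-remove []             q = z≤n
rowSum-remove ((i , j) ∷ D) q with (i , j) ≟c q
... | yes _ = ≤-trans (rowSum-remove D q) (m≤n+m (rowSum D) i)
... | no _  = +-monoʳ-≤ i (rowSum-remove D q)

rowSum-remove-∈ : ∀ D q → q ∈ D → rowSum (filter (λ x → ¬? (x ≟c q)) D) + proj₁ q ≤ rowSum D
rowSum-remove-∈ ((i , j) ∷ D) q q∈ with (i , j) ≟c q
rowSum-remove-∈ ((i , j) ∷ D) _ _          | yes refl =
  ≤-trans (≤-reflexive (+-comm _ i)) (+-monoʳ-≤ i (rowSum-remove D (i , j)))
rowSum-remove-∈ ((i , j) ∷ D) q (here q≡)  | no q≢ = ⊥-elim (q≢ (sym q≡))
rowSum-remove-∈ ((i , j) ∷ D) q (there q∈) | no _  =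
  ≤-trans (≤-reflexive (+-assoc i _ _)) (+-monoʳ-≤ i (rowSum-remove-∈ D q q∈))

rowSum-drop : ∀ {D t j s} → Drop D t j s → rowSum (kohnert t D) < rowSum D
rowSum-drop {D} {t} {j} {s} d rewrite kohnert-drop d = begin-strict
  s + rowSum rest <⟨ +-monoˡ-< (rowSum rest) (Drop.s<t d) ⟩
  t + rowSum rest ≡⟨ +-comm t _ ⟩
  rowSum rest + t ≤⟨ rowSum-remove-∈ D (t , j) (proj₁ (Drop.rowMax d)) ⟩
  rowSum D        ∎
  where
  open ≤-Reasoning
  rest = filter (λ x → ¬? (x ≟c (t , j))) D

module NotRanked (D₀ : Diagram) (ρ : Diagram → ℕ)
  (ρ-≈      : ∀ D E → D ∈KD D₀ → E ∈KD D₀ → D ≈ E → ρ D ≡ ρ E)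
  (ρ-covers : ∀ D E → D ∈KD D₀ → E ∈KD D₀ → Covers D₀ D E → ρ D ≡ suc (ρ E))
  {r p c : ℕ} (1≤r : 1 ≤ r) (r<p : r < p) where

  Reach : Diagram → Set
  Reach = Star Step D₀

  reach⇒KD : ∀ {W} → Reach W → W ∈KD D₀
  reach⇒KD {W} D₀⇝W = W , D₀⇝W , ≈-refl

  reach-kohnert : ∀ {W} t → Reach W → Reach (kohnert t W)
  reach-kohnert t D₀⇝W = D₀⇝W ◅◅ ((t , refl) ◅ ε)

  rank-drop : ∀ {W t j s} → Reach W → Drop W t j s → RightCellsBetween W t j s → ρ W ≡ suc (ρ (kohnert t W))
  rank-drop {t = t} D₀⇝W d support =
    ρ-covers _ _ (reach⇒KD D₀⇝W) (reach⇒KD (reach-kohnert t D₀⇝W)) (DropCovers.covers d support D₀)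

  1≤p : 1 ≤ p
  1≤p = ≤-trans 1≤r (<⇒≤ r<p)

  r<p+1 : r < suc p
  r<p+1 = m<n⇒m<1+n r<p

  record Frame (W : Diagram) : Set where
    field
      column  : ∀ x → r < x → x ≤ suc p → (x , c) ∈ W
      hole    : (r , c) ∉ W
      support : ∀ x → r < x → x < p → CellRightOf W x c

  frame-drop : ∀ {W W' t s y} → Frame W → Moves W (t , y) (s , y) W' → c < y → p ≤ t → Frame W'
  frame-drop {t = t} frame W⇝W' c<y p≤t = record
    { column  = λ x r<x x≤p+1 → moves-keep W⇝W' (column x r<x x≤p+1) (col≢ (<⇒≢ c<y))
    ; hole    = λ r∈ → hole (moves-source W⇝W' r∈ (col≢ (<⇒≢ c<y)))
    ; support = λ x r<x x<p → let (z , c<z , z∈) = support x r<x x<p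
                              in z , c<z , moves-keep W⇝W' z∈ (row≢ (<⇒≢ (<-≤-trans x<p p≤t)))
    }
    where open Frame frame

  no-rows-between : ∀ {V j} → RightCellsBetween V (suc p) j p
  no-rows-between x p<x x<p+1 = ⊥-elim (<⇒≱ p<x (≤-pred x<p+1))

  record Twins (W J : Diagram) : Set where
    field
      reachW  : Reach W
      reachJ  : Reach J
      frame   : Frame W
      W⇝J     : Moves W (p , c) (r , c) J
      rank    : ρ W ≡ suc (ρ J)
      noClash : ∀ z → c < z → (suc p , z) ∈ W → (p , z) ∉ W
      beyond  : CellRightOf W (suc p) c ⊎ CellRightOf W p c

  twins-drop : ∀ {W J y} → Twins W J → RowMax (suc p) W y → c < y → Drop W (suc p) y p
  twins-drop twins y-max c<y = drop-adjacent y-max 1≤p (Twins.noClash twins _ c<y (proj₁ y-max))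

  twins-step : ∀ {W J y} → Twins W J → c < y → Drop W (suc p) y p →
               Twins (kohnert (suc p) W) (kohnert (suc p) J)
  twins-step {W} {J} {y} twins c<y dW = record
    { reachW  = reach-kohnert (suc p) reachW
    ; reachJ  = reach-kohnert (suc p) reachJ
    ; frame   = frame-drop frame W⇝W' c<y (n≤1+n p)
    ; W⇝J     = moves-comm W⇝W' J⇝J' W⇝J (col≢ (>⇒≢ c<y)) (row≢ (<⇒≢ r<p+1))
    ; rank    = suc-injective (trans (sym (rank-drop reachW dW no-rows-between))
                                     (trans rank (cong suc (rank-drop reachJ dJ no-rows-between))))
    ; noClash = noClash'
    ; beyond  = inj₂ (y , c<y , moves-target W⇝W')
    }
    where
    open Twins twins
    p≢p+1 : p ≢ suc p
    p≢p+1 = <⇒≢ (n<1+n p)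
    dJ : Drop J (suc p) y p
    dJ = drop-adjacent (moves-rowMax W⇝J (≢-sym p≢p+1) (>⇒≢ r<p+1) (Drop.rowMax dW)) 1≤p
                       (λ p∈ → Drop.free dW (moves-source W⇝J p∈ (row≢ (>⇒≢ r<p))))
    W⇝W' : Moves W (suc p , y) (p , y) (kohnert (suc p) W)
    W⇝W' = kohnert-moves dW
    J⇝J' : Moves J (suc p , y) (p , y) (kohnert (suc p) J)
    J⇝J' = kohnert-moves dJ
    noClash' : ∀ z → c < z → (suc p , z) ∈ kohnert (suc p) W → (p , z) ∉ kohnert (suc p) W
    noClash' z c<z top∈ below∈ with z ℕ.≟ y
    ... | yes refl = moves-vacates W⇝W' (row≢ p≢p+1) top∈
    ... | no z≢y   = noClash z c<z (moves-source W⇝W' top∈ (row≢ (≢-sym p≢p+1)))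
                                   (moves-source W⇝W' below∈ (col≢ z≢y))

  twins-end : ∀ {W J} → Twins W J → RowMax (suc p) W c → ⊥
  twins-end {W} {J} twins c-max = 1+n≰n (≤-reflexive (sym ranks))
    where
    open Twins twins
    open Frame frame
    beyond-p : CellRightOf W p c
    beyond-p with beyond
    ... | inj₁ (z , c<z , z∈) = ⊥-elim (<⇒≱ c<z (proj₂ c-max z z∈))
    ... | inj₂ b              = b
    supportW : ∀ x → r < x → x < suc p → CellRightOf W x c
    supportW x r<x x<p+1 with m≤n⇒m<n∨m≡n (≤-pred x<p+1)
    ... | inj₁ x<p  = support x r<x x<p
    ... | inj₂ refl = beyond-p
    dW : Drop W (suc p) c r
    dW = record { rowMax = c-max ; 1≤s = 1≤r ; s<t = r<p+1 ; free = hole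
                ; filled = λ x r<x x<p+1 → column x r<x (<⇒≤ x<p+1) }
    dJ : Drop J (suc p) c p
    dJ = drop-adjacent (moves-rowMax W⇝J (>⇒≢ (n<1+n p)) (>⇒≢ r<p+1) c-max) 1≤p
                       (moves-vacates W⇝J (row≢ (<⇒≢ r<p)))
    Y = kohnert (suc p) W
    Y' = kohnert (suc p) J
    Y'≈Y : Y' ≈ Y
    Y'≈Y = move-then-fill W⇝J (kohnert-moves dJ) (kohnert-moves dW) (column p r<p (n≤1+n p))
             (row≢ (<⇒≢ (n<1+n p))) (row≢ (<⇒≢ r<p+1))
    ranks : suc (ρ Y) ≡ suc (suc (ρ Y))
    ranks = begin
      suc (ρ Y)        ≡⟨ rank-drop reachW dW supportW ⟨
      ρ W              ≡⟨ rank ⟩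
      suc (ρ J)        ≡⟨ cong suc (rank-drop reachJ dJ no-rows-between) ⟩
      suc (suc (ρ Y')) ≡⟨ cong (λ n → suc (suc n)) (ρ-≈ Y' Y (reach⇒KD (reach-kohnert (suc p) reachJ))
                                                        (reach⇒KD (reach-kohnert (suc p) reachW)) Y'≈Y) ⟩
      suc (suc (ρ Y))  ∎
      where open ≡-Reasoning

  twins-absurd : ∀ n {W J} → rowSum W < n → Twins W J → ⊥
  twins-absurd (suc n) {W} bound twins with maxCol (suc p) W | maxCol-view (suc p) W
  ... | _ | empty-row none = none c (Frame.column (Twins.frame twins) (suc p) r<p+1 ≤-refl)
  ... | _ | max-col y y-max with c ℕ.<? y
  ...   | yes c<y = twins-absurd n (<-≤-trans (rowSum-drop dW) (≤-pred bound)) (twins-step twins c<y dW)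
    where dW = twins-drop twins y-max c<y
  ...   | no c≮y =
    twins-end twins (rowMax-lower y-max (Frame.column (Twins.frame twins) (suc p) r<p+1 ≤-refl) (≮⇒≥ c≮y))

  record Clearing (W : Diagram) : Set where
    field
      reach : Reach W
      frame : Frame W
      top   : CellRightOf W (suc p) c
      free  : ∀ z → c < z → ∃[ x ] (1 ≤ x × x < suc p × (x , z) ∉ W)

  twins-start : ∀ {W} → Clearing W → RowMax p W c → Twins W (kohnert p W)
  twins-start {W} clearing c-max = record
    { reachW  = reach
    ; reachJ  = reach-kohnert p reach
    ; frame   = frame
    ; W⇝J     = kohnert-moves d
    ; rank    = rank-drop reach d support
    ; noClash = λ z c<z _ z∈ → <⇒≱ c<z (proj₂ c-max z z∈)
    ; beyond  = inj₁ top
    }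
    where
    open Clearing clearing
    open Frame frame
    d : Drop W p c r
    d = record { rowMax = c-max ; 1≤s = 1≤r ; s<t = r<p ; free = hole
               ; filled = λ x r<x x<p → column x r<x (≤-trans (<⇒≤ x<p) (n≤1+n p)) }

  clearing-drop : ∀ {W y} → Clearing W → RowMax p W y → c < y → ∃[ s ] Drop W p y s
  clearing-drop {W} {y} clearing y-max c<y with Clearing.free clearing y c<y
  ... | x , 1≤x , x<p+1 , x∉ with m≤n⇒m<n∨m≡n (≤-pred x<p+1)
  ...   | inj₁ x<p  = drop-exists y-max 1≤x x<p x∉
  ...   | inj₂ refl = ⊥-elim (x∉ (proj₁ y-max))

  clearing-step : ∀ {W y s} → Clearing W → c < y → Drop W p y s → Clearing (kohnert p W)
  clearing-step {W} {y} clearing c<y d = record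
    { reach = reach-kohnert p reach
    ; frame = frame-drop frame W⇝W' c<y ≤-refl
    ; top   = let (z , c<z , z∈) = top in z , c<z , moves-keep W⇝W' z∈ (row≢ (>⇒≢ (n<1+n p)))
    ; free  = free'
    }
    where
    open Clearing clearing
    W⇝W' = kohnert-moves d
    free' : ∀ z → c < z → ∃[ x ] (1 ≤ x × x < suc p × (x , z) ∉ kohnert p W)
    free' z c<z with z ℕ.≟ y
    ... | yes refl = p , 1≤p , n<1+n p , moves-vacates W⇝W' (row≢ (<⇒≢ (Drop.s<t d)))
    ... | no z≢y   = let (x , 1≤x , x<p+1 , x∉) = free z c<z
                     in x , 1≤x , x<p+1 , λ x∈ → x∉ (moves-source W⇝W' x∈ (col≢ z≢y))

  clearing-absurd : ∀ n {W} → rowSum W < n → Clearing W → ⊥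
  clearing-absurd (suc n) {W} bound clearing with maxCol p W | maxCol-view p W
  ... | _ | empty-row none = none c (Frame.column (Clearing.frame clearing) p r<p (n≤1+n p))
  ... | _ | max-col y y-max with c ℕ.<? y
  ...   | yes c<y = let (s , d) = clearing-drop clearing y-max c<y in
    clearing-absurd n (<-≤-trans (rowSum-drop d) (≤-pred bound)) (clearing-step clearing c<y d)
  ...   | no c≮y = twins-absurd _ ≤-refl (twins-start clearing
    (rowMax-lower y-max (Frame.column (Clearing.frame clearing) p r<p (n≤1+n p)) (≮⇒≥ c≮y)))

theorem3p5 : (D₀ : Diagram) → ValidDiagram D₀ →
    (D : Diagram) → D ∈KD D₀ →
    (r r' c c' : ℕ) → 1 ≤ c → c < c' → 1 ≤ r → r < r' ∸ 1 →
    ((r' , c') ∈ D) → (∀ c̃ → c' < c̃ → (r' , c̃) ∉ D) →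
    (∀ r̃ → r < r̃ → r̃ ≤ r' → (r̃ , c) ∈ D) →
    ((r , c) ∉ D) →
    (∀ r̃ → r < r̃ → r̃ < r' ∸ 1 → ∃[ c̃ ] (c < c̃ × (r̃ , c̃) ∈ D)) →
    (∀ c̃ → c < c̃ → ∃[ r̃ ] (1 ≤ r̃ × r̃ < r' × (r̃ , c̃) ∉ D)) →
    ¬ Ranked D₀
theorem3p5 D₀ _ D (F , D₀⇝F , F≈D) r (suc p) c c' _ c<c' 1≤r r<p c'∈ _ column hole support free
           (ρ , ρ-≈ , _ , ρ-covers) = clearing-absurd _ ≤-refl clearing
  where
  open NotRanked D₀ ρ ρ-≈ ρ-covers 1≤r r<p
  D⊆F : ∀ {x} → x ∈ D → x ∈ F
  D⊆F {x} = proj₂ (F≈D x)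
  clearing : Clearing F
  clearing = record
    { reach = D₀⇝F
    ; frame = record
      { column  = λ x r<x x≤p+1 → D⊆F (column x r<x x≤p+1)
      ; hole    = λ r∈ → hole (proj₁ (F≈D _) r∈)
      ; support = λ x r<x x<p → let (z , c<z , z∈) = support x r<x x<p in z , c<z , D⊆F z∈
      }
    ; top   = c' , c<c' , D⊆F c'∈
    ; free  = λ z c<z → let (x , 1≤x , x<p+1 , x∉) = free z c<z
                        in x , 1≤x , x<p+1 , λ x∈ → x∉ (proj₁ (F≈D _) x∈)
    }
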